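{- Let $r\in\mathbb{N}\cup\{\infty\}$, let $G$ be a weighted graph, let $\theta\subseteq G$ be a theta-graph of parameter $r$, and let $o$ be a cycle of $G$ of length at most $r$ which contains a branching vertex $v$ of $\theta$ and contains a path $P$ joining interior vertices of two different arms of $\theta$, where $P$ avoids the branching vertices of $\theta$. Then at most one $\theta$-bridge included in $o$ is secondary (with respect to $v$).
   Context: All graphs are simple and weighted: every edge has a positive integer length; the length of a path or cycle is the sum of the lengths of its edges. A theta-graph of parameter $r$ consists of two vertices (the branching vertices) and three internally disjoint paths between them (the arms) such that at least two of the three cycles formed by two arms have length at most $r$. An arc is a subpath of $o$ with at least one edge that meets $\theta$ precisely in its endvertices; it is a $\theta$-bridge if its endvertices are interior vertices of different arms of $\theta$. A $\theta$-bridge $Q$ included in $o$ is primary if it has an endvertex $x$ such that a shortest path within the cycle $o$ from $x$ to $v$ includes $Q$; a bridge that is not primary is secondary. -}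

module Defs where

open import Data.Nat using (ℕ; _+_; _≤_; _<_)
open import Data.Unit using (⊤)
open import Data.Fin using (Fin)
open import Data.List using (List; []; _∷_; _++_; take; head; last; length; map; reverse)
open import Data.Nat.ListAction using (sum)
open import Data.List.Membership.Propositional using (_∈_; _∉_)
open import Data.List.Relation.Unary.All using (All)
open import Data.List.Relation.Unary.Unique.Propositional using (Unique)
open import Data.Maybe using (Maybe; just)
open import Data.Product using (Σ; ∃; ∃-syntax; _×_; _,_)
open import Data.Sum using (_⊎_)
open import Relation.Binary.PropositionalEquality using (_≡_; _≢_)
open import Relation.Nullary using (¬_)

data ℕ∞ : Set where
  fin : ℕ → ℕ∞
  ∞   : ℕ∞

infix 4 _≤∞_
_≤∞_ : ℕ → ℕ∞ → Set
n ≤∞ fin r = n ≤ r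
n ≤∞ ∞     = ⊤

-- Simple weighted graphs.  w x y is the (positive integer) length of the
-- edge xy, and w x y ≡ 0 encodes that x and y are not adjacent.

record WGraph : Set₁ where
  field
    V       : Set
    w       : V → V → ℕ
    w-sym   : ∀ x y → w x y ≡ w y x
    w-loop  : ∀ x → w x x ≡ 0

edges : {A : Set} → List A → List (A × A)
edges []           = []
edges (x ∷ [])     = []
edges (x ∷ y ∷ xs) = (x , y) ∷ edges (y ∷ xs)

dropLast : {A : Set} → List A → List A
dropLast []           = []
dropLast (x ∷ [])     = []
dropLast (x ∷ y ∷ ys) = x ∷ dropLast (y ∷ ys)

interior : {A : Set} → List A → List A
interior []       = []
interior (x ∷ xs) = dropLast xs

_∈ᵉ_ : {A : Set} → A × A → List (A × A) → Set
(x , y) ∈ᵉ es = ((x , y) ∈ es) ⊎ ((y , x) ∈ es)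

module _ (G : WGraph) where
  open WGraph G

  Adj : V → V → Set
  Adj x y = 1 ≤ w x y

  wt : V × V → ℕ
  wt (x , y) = w x y

  IsPath : List V → Set
  IsPath p = (1 ≤ length p) × Unique p × All (λ e → Adj (Data.Product.proj₁ e) (Data.Product.proj₂ e)) (edges p)

  pathLen : List V → ℕ
  pathLen p = sum (map wt (edges p))

  IsPathFromTo : List V → V → V → Set
  IsPathFromTo p x y = IsPath p × head p ≡ just x × last p ≡ just y

  cycleEdges : List V → List (V × V)
  cycleEdges c = edges (c ++ take 1 c)

  IsCycle : List V → Set
  IsCycle c = (3 ≤ length c) × Unique c × All (λ e → Adj (Data.Product.proj₁ e) (Data.Product.proj₂ e)) (cycleEdges c)

  cycleLen : List V → ℕ
  cycleLen c = sum (map wt (cycleEdges c))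

  PathIn : List V → List V → Set
  PathIn o p = IsPath p × All (_∈ o) p × All (_∈ᵉ cycleEdges o) (edges p)

  PathIncluded : List V → List V → Set
  PathIncluded Q R = All (_∈ R) Q × All (_∈ᵉ edges R) (edges Q)

  record Theta (r : ℕ∞) : Set where
    field
      a b      : V
      arm      : Fin 3 → List V
      a≢b      : a ≢ b
      arm-path : ∀ i → IsPathFromTo (arm i) a b
      arm-distinct : ∀ i j → i ≢ j → arm i ≢ arm j
      arm-disj : ∀ i j → i ≢ j → ∀ x → x ∈ interior (arm i) → x ∉ interior (arm j)
      -- at least two of the three cycles formed by two arms have length ≤ r
      short : ((pathLen (arm Fin.zero) + pathLen (arm (Fin.suc Fin.zero)) ≤∞ r)
               × (pathLen (arm Fin.zero) + pathLen (arm (Fin.suc (Fin.suc Fin.zero))) ≤∞ r))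
            ⊎ ((pathLen (arm Fin.zero) + pathLen (arm (Fin.suc Fin.zero)) ≤∞ r)
               × (pathLen (arm (Fin.suc Fin.zero)) + pathLen (arm (Fin.suc (Fin.suc Fin.zero))) ≤∞ r))
            ⊎ ((pathLen (arm Fin.zero) + pathLen (arm (Fin.suc (Fin.suc Fin.zero))) ≤∞ r)
               × (pathLen (arm (Fin.suc Fin.zero)) + pathLen (arm (Fin.suc (Fin.suc Fin.zero))) ≤∞ r))

  module _ {r : ℕ∞} (θ : Theta r) where
    open Theta θ

    InΘ : V → Set
    InΘ x = ∃[ i ] x ∈ arm i

    EdgeOfΘ : V × V → Set
    EdgeOfΘ e = ∃[ i ] e ∈ᵉ edges (arm i)

    Branching : V → Set
    Branching x = (x ≡ a) ⊎ (x ≡ b)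

    JoinsDifferentArms : V → V → Set
    JoinsDifferentArms x y = ∃[ i ] ∃[ j ] (i ≢ j × x ∈ interior (arm i) × y ∈ interior (arm j))

    IsArc : List V → List V → Set
    IsArc o Q = PathIn o Q × 2 ≤ length Q
      × Σ V λ x → Σ V λ y → head Q ≡ just x × last Q ≡ just y
        × InΘ x × InΘ y
        × All (λ z → InΘ z → (z ≡ x) ⊎ (z ≡ y)) Q
        × All (λ e → ¬ EdgeOfΘ e) (edges Q)

    IsBridge : List V → List V → Set
    IsBridge o Q = IsArc o Q
      × Σ V λ x → Σ V λ y → head Q ≡ just x × last Q ≡ just y × JoinsDifferentArms x y

    ShortestIn : List V → List V → V → V → Set
    ShortestIn o R x v = PathIn o R × IsPathFromTo R x v
      × (∀ R' → PathIn o R' → IsPathFromTo R' x v → pathLen R ≤ pathLen R')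

    Primary : List V → V → List V → Set
    Primary o v Q = Σ V λ x → ((head Q ≡ just x) ⊎ (last Q ≡ just x))
      × Σ (List V) λ R → ShortestIn o R x v × PathIncluded Q R

    Secondary : List V → V → List V → Set
    Secondary o v Q = IsBridge o Q × ¬ Primary o v Q

module Submission where

-- Cut the cycle o open at the branching vertex v: as a
-- closed walk it reads  v , u₁ , … , uₖ , v , where  u = u₁ … uₖ v  lists
-- every vertex of o once.  A θ-bridge meets θ only in its ends, which are
-- interior vertices of arms; since v lies on θ and is not such a vertex, the
-- bridge avoids v and is a contiguous segment  h … t  of u (read in one of
-- its two directions).  Let s and e be the lengths of the walk from v to h
-- and to t, and L the length of o.  Every path in o from a vertex z to v is
-- at least as long as the shorter of the two arcs of the walk cut at z
-- ("distance lower bound").  Hence if 2e ≤ L the arc from t back to v is a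
-- shortest path containing the bridge, and if L ≤ 2s so is the arc from h
-- forward to v: the bridge is primary.  A secondary bridge therefore
-- straddles the antipode of v:  2s < L < 2e.  Two bridges occupying
-- different segments do not overlap, so if one precedes the other then
-- e₁ ≤ s₂, and they cannot both straddle the antipode.  Hence all secondary
-- bridges occupy the same segment of u, i.e. are equal up to reversal.

open import Data.Nat using (ℕ; _+_; _≤_; _<_; z≤n; s≤s; _⊓_; _≤?_)
open import Data.Nat.Properties
  using ( +-assoc; +-comm; +-identityʳ; ≤-refl; ≤-trans; ≤-reflexive; m≤m+n; m≤n+m
        ; +-monoʳ-≤; +-monoˡ-≤; +-mono-≤; +-cancelˡ-≤; ⊓-mono-≤; +-distribʳ-⊓; m⊓n≤m; m⊓n≤n
        ; m≤n⇒m⊓n≡m; m≥n⇒m⊓n≡n; ≰⇒>; <-≤-trans; <-trans; <-irrefl)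
open import Data.Fin using (Fin)
open import Data.List using (List; []; _∷_; _++_; [_]; reverse; head; last; length; take)
open import Data.List.Properties
  using ( ++-assoc; ++-identityʳ; ∷-injective; ∷ʳ-injectiveʳ
        ; reverse-++; unfold-reverse; reverse-involutive)
open import Data.List.Relation.Unary.All as All using (All; []; _∷_)
open import Data.List.Relation.Unary.Any using (here; there)
open import Data.List.Relation.Unary.Any.Properties using (¬Any[]; reverse⁺; reverse⁻)
open import Data.List.Relation.Unary.AllPairs using ([]; _∷_)
open import Data.List.Relation.Unary.Unique.Propositional using (Unique)
open import Data.List.Membership.Propositional using (_∈_; _∉_)
open import Data.List.Membership.Propositional.Properties using (∈-++⁺ˡ; ∈-++⁺ʳ; ∈-∃++)
open import Data.List.Relation.Binary.Permutation.Propositional as Perm using (_↭_; prep; swap; ↭-sym; ↭-reflexive)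
open import Data.List.Relation.Binary.Permutation.Propositional.Properties
  using (All-resp-↭; ∈-resp-↭; ++-comm; ∷↭∷ʳ; ↭-reverse)
open import Data.Maybe using (just)
open import Data.Maybe.Properties using (just-injective)
open import Data.Product using (Σ; _×_; _,_; proj₁; proj₂)
open import Data.Sum using (_⊎_; inj₁; inj₂)
open import Data.Empty using (⊥; ⊥-elim)
open import Relation.Binary.PropositionalEquality
  using (_≡_; _≢_; refl; sym; trans; cong; cong₂; subst; module ≡-Reasoning)
open import Relation.Nullary using (¬_; yes; no)
open import Function using (_∘_)
open import Defs

module ListFacts {A : Set} where

  ++-cases : ∀ (X₁ X₂ : List A) {A₁ A₂ : List A} → X₁ ++ A₁ ≡ X₂ ++ A₂ →
      (Σ (List A) λ M → X₂ ≡ X₁ ++ M × A₁ ≡ M ++ A₂)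
    ⊎ (Σ (List A) λ M → X₁ ≡ X₂ ++ M × A₂ ≡ M ++ A₁)
  ++-cases []       X₂       eq = inj₁ (X₂ , refl , eq)
  ++-cases (x ∷ X₁) []       eq = inj₂ (x ∷ X₁ , refl , sym eq)
  ++-cases (x ∷ X₁) (y ∷ X₂) eq with ∷-injective eq
  ... | refl , eq′ with ++-cases X₁ X₂ eq′
  ... | inj₁ (M , e₁ , e₂) = inj₁ (M , cong (x ∷_) e₁ , e₂)
  ... | inj₂ (M , e₁ , e₂) = inj₂ (M , cong (x ∷_) e₁ , e₂)

  unique-position : ∀ (P P′ : List A) {z : A} {B B′ : List A} → Unique (P ++ z ∷ B) →
    P ++ z ∷ B ≡ P′ ++ z ∷ B′ → P ≡ P′ × B ≡ B′
  unique-position []      []       u        eq = refl , proj₂ (∷-injective eq)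
  unique-position []      (a ∷ P′) (z∉ ∷ _) eq with ∷-injective eq
  ... | refl , eq′ = ⊥-elim (All.lookup z∉ (subst (_ ∈_) (sym eq′) (∈-++⁺ʳ P′ (here refl))) refl)
  unique-position (a ∷ P) []       (z∉ ∷ _) eq with ∷-injective eq
  ... | refl , _   = ⊥-elim (All.lookup z∉ (∈-++⁺ʳ P (here refl)) refl)
  unique-position (a ∷ P) (b ∷ P′) (_ ∷ u)  eq with ∷-injective eq
  ... | refl , eq′ with unique-position P P′ u eq′
  ... | e₁ , e₂ = cong (a ∷_) e₁ , e₂

  Unique-resp-↭ : ∀ {xs ys : List A} → xs ↭ ys → Unique xs → Unique ys
  Unique-resp-↭ Perm.refl u = u
  Unique-resp-↭ (prep x p) (x∉ ∷ u) = All-resp-↭ p x∉ ∷ Unique-resp-↭ p u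
  Unique-resp-↭ (swap x y p) ((x≢y ∷ x∉) ∷ (y∉ ∷ u)) =
    ((λ e → x≢y (sym e)) ∷ All-resp-↭ p y∉) ∷ (All-resp-↭ p x∉ ∷ Unique-resp-↭ p u)
  Unique-resp-↭ (Perm.trans p q) u = Unique-resp-↭ q (Unique-resp-↭ p u)

  Unique-++⁻ˡ : ∀ (xs : List A) {ys} → Unique (xs ++ ys) → Unique xs
  Unique-++⁻ˡ []       u        = []
  Unique-++⁻ˡ (x ∷ xs) (x∉ ∷ u) = All.tabulate (λ m → All.lookup x∉ (∈-++⁺ˡ m)) ∷ Unique-++⁻ˡ xs u

  Unique-++⁻ʳ : ∀ (xs : List A) {ys} → Unique (xs ++ ys) → Unique ys
  Unique-++⁻ʳ []       u       = u
  Unique-++⁻ʳ (x ∷ xs) (_ ∷ u) = Unique-++⁻ʳ xs u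

  Unique-∷ʳ⇒∉ : ∀ (D : List A) {b} → Unique (D ++ [ b ]) → b ∉ D
  Unique-∷ʳ⇒∉ D {b} u m with ∈-∃++ m
  ... | P , B , refl with Unique-++⁻ʳ P (subst Unique (++-assoc P (b ∷ B) [ b ]) u)
  ... | b∉ ∷ _ = All.lookup b∉ (∈-++⁺ʳ B (here refl)) refl

  edges-++⁺ʳ : ∀ (l : List A) {m e} → e ∈ edges m → e ∈ edges (l ++ m)
  edges-++⁺ʳ []      p = p
  edges-++⁺ʳ (x ∷ l) {m} p with l ++ m | edges-++⁺ʳ l {m} p
  ... | []    | ()
  ... | y ∷ r | q = there q

  edges-++⁺ˡ : ∀ (l : List A) {m e} → e ∈ edges l → e ∈ edges (l ++ m)
  edges-++⁺ˡ (x ∷ y ∷ l) (here refl) = here refl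
  edges-++⁺ˡ (x ∷ y ∷ l) (there p)   = there (edges-++⁺ˡ (y ∷ l) p)

  edges-++-∷ : ∀ (xs : List A) y ys → edges (xs ++ y ∷ ys) ≡ edges (xs ++ [ y ]) ++ edges (y ∷ ys)
  edges-++-∷ []            y ys = refl
  edges-++-∷ (x ∷ [])      y ys = refl
  edges-++-∷ (x ∷ x′ ∷ xs) y ys = cong ((x , x′) ∷_) (edges-++-∷ (x′ ∷ xs) y ys)

  edge-split : ∀ (l : List A) {a b} → (a , b) ∈ edges l →
    Σ (List A) λ P → Σ (List A) λ B → l ≡ P ++ a ∷ b ∷ B
  edge-split (x ∷ y ∷ l) (here refl) = [] , l , refl
  edge-split (x ∷ y ∷ l) (there p) with edge-split (y ∷ l) p
  ... | P , B , eq = x ∷ P , B , cong (x ∷_) eq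

  edges-∷-cases : ∀ (v : A) l {a b} → (a , b) ∈ edges (v ∷ l) →
    (a ≡ v × head l ≡ just b) ⊎ (a , b) ∈ edges l
  edges-∷-cases v (c ∷ l) (here refl) = inj₁ (refl , refl)
  edges-∷-cases v (c ∷ l) (there p)   = inj₂ p

  edge-at : ∀ (P : List A) {a b B} → (a , b) ∈ edges (P ++ a ∷ b ∷ B)
  edge-at P = edges-++⁺ʳ P (here refl)

  edge-∈ : ∀ (l : List A) {a b} → (a , b) ∈ edges l → a ∈ l × b ∈ l
  edge-∈ l p with edge-split l p
  ... | P , B , refl = ∈-++⁺ʳ P (here refl) , ∈-++⁺ʳ P (there (here refl))

  reverse-∷-∷ʳ : ∀ (h : A) mid t → reverse (h ∷ mid ++ [ t ]) ≡ t ∷ reverse mid ++ [ h ]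
  reverse-∷-∷ʳ h mid t = trans (unfold-reverse h (mid ++ [ t ])) (cong (_++ [ h ]) (reverse-++ mid [ t ]))

  reverse-around-pair : ∀ (P : List A) a b B → reverse (P ++ a ∷ b ∷ B) ≡ reverse B ++ b ∷ a ∷ reverse P
  reverse-around-pair P a b B = begin
    reverse (P ++ a ∷ b ∷ B)                   ≡⟨ reverse-++ P (a ∷ b ∷ B) ⟩
    reverse (a ∷ b ∷ B) ++ reverse P           ≡⟨ cong (_++ reverse P) (reverse-++ (a ∷ [ b ]) B) ⟩
    (reverse B ++ b ∷ [ a ]) ++ reverse P      ≡⟨ ++-assoc (reverse B) (b ∷ [ a ]) (reverse P) ⟩
    reverse B ++ b ∷ a ∷ reverse P             ∎
    where open ≡-Reasoning

  edges-reverse⁺ : ∀ (l : List A) {a b} → (a , b) ∈ edges l → (b , a) ∈ edges (reverse l)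
  edges-reverse⁺ l p with edge-split l p
  ... | P , B , refl = subst (λ z → _ ∈ edges z) (sym (reverse-around-pair P _ _ B)) (edge-at (reverse B))

  edges-reverse⁻ : ∀ (l : List A) {a b} → (a , b) ∈ edges (reverse l) → (b , a) ∈ edges l
  edges-reverse⁻ l p = subst (λ z → _ ∈ edges z) (reverse-involutive l) (edges-reverse⁺ (reverse l) p)

  ∈ᵉ-swap : ∀ {a b : A} {es} → (a , b) ∈ᵉ es → (b , a) ∈ᵉ es
  ∈ᵉ-swap (inj₁ p) = inj₂ p
  ∈ᵉ-swap (inj₂ p) = inj₁ p

  last-∷ʳ : ∀ (l : List A) t → last (l ++ [ t ]) ≡ just t
  last-∷ʳ []          t = refl
  last-∷ʳ (x ∷ [])    t = refl
  last-∷ʳ (x ∷ y ∷ l) t = last-∷ʳ (y ∷ l) t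

  last-++-∷ : ∀ (l : List A) x m → last (l ++ x ∷ m) ≡ last (x ∷ m)
  last-++-∷ []          x m = refl
  last-++-∷ (y ∷ [])    x m = refl
  last-++-∷ (y ∷ z ∷ l) x m = last-++-∷ (z ∷ l) x m

  head∈ : ∀ (l : List A) {b} → head l ≡ just b → b ∈ l
  head∈ (x ∷ l) refl = here refl

  last∈ : ∀ (l : List A) {b} → last l ≡ just b → b ∈ l
  last∈ (x ∷ [])    refl = here refl
  last∈ (x ∷ y ∷ l) eq   = there (last∈ (y ∷ l) eq)

  head-position : ∀ (l : List A) P {c B} → Unique l → head l ≡ just c → l ≡ P ++ c ∷ B → P ≡ []
  head-position (c ∷ l) P ul refl eq = sym (proj₁ (unique-position [] P ul eq))

  module _ {P : A → Set} where

    first-hit : ∀ (m₁ m₂ : List A) {t₁ t₂ Y₁ Y₂} → P t₁ → P t₂ →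
      (∀ {z} → z ∈ m₁ → ¬ P z) → (∀ {z} → z ∈ m₂ → ¬ P z) →
      m₁ ++ t₁ ∷ Y₁ ≡ m₂ ++ t₂ ∷ Y₂ → m₁ ≡ m₂ × t₁ ≡ t₂
    first-hit []       []       _   _   _   _   eq = refl , proj₁ (∷-injective eq)
    first-hit []       (b ∷ m₂) Pt₁ _   _   ¬P₂ eq with ∷-injective eq
    ... | refl , _ = ⊥-elim (¬P₂ (here refl) Pt₁)
    first-hit (a ∷ m₁) []       _   Pt₂ ¬P₁ _   eq with ∷-injective eq
    ... | refl , _ = ⊥-elim (¬P₁ (here refl) Pt₂)
    first-hit (a ∷ m₁) (b ∷ m₂) Pt₁ Pt₂ ¬P₁ ¬P₂ eq with ∷-injective eq
    ... | refl , eq′ with first-hit m₁ m₂ Pt₁ Pt₂ (¬P₁ ∘ there) (¬P₂ ∘ there) eq′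
    ... | refl , refl = refl , refl

    -- A P-element h′ cannot lie inside a P-free block m, so the element t
    -- ending the block comes no later than h′.
    hit-before : ∀ (m M : List A) {t h′ Y rest} → P h′ → (∀ {z} → z ∈ m → ¬ P z) →
      m ++ t ∷ Y ≡ M ++ h′ ∷ rest → Σ (List A) λ K′ → M ≡ m ++ K′ × t ∷ Y ≡ K′ ++ h′ ∷ rest
    hit-before m M Ph′ ¬P eq with ++-cases m M eq
    ... | inj₁ (K′ , M≡ , eq′)      = K′ , M≡ , eq′
    ... | inj₂ ([] , m≡ , eq′)      = [] , sym (trans (++-identityʳ m) (trans m≡ (++-identityʳ M))) , sym eq′
    ... | inj₂ (k ∷ M₀ , m≡ , eq′) with ∷-injective eq′
    ...   | refl , _ = ⊥-elim (¬P (subst (_ ∈_) (sym m≡) (∈-++⁺ʳ M (here refl))) Ph′)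

  ends-and-middle : ∀ (l : List A) → 2 ≤ length l →
    Σ A λ h → Σ (List A) λ mid → Σ A λ t → l ≡ h ∷ mid ++ [ t ]
  ends-and-middle (x ∷ y ∷ [])    _ = x , [] , y , refl
  ends-and-middle (x ∷ y ∷ z ∷ l) _ with ends-and-middle (y ∷ z ∷ l) (s≤s (s≤s z≤n))
  ... | h , mid , t , eq = x , h ∷ mid , t , cong (x ∷_) eq
  ends-and-middle (x ∷ [])        (s≤s ())

  last-view : ∀ (a : A) ps b → last (a ∷ ps) ≡ just b → (ps ≡ []) ⊎ (ps ≡ dropLast ps ++ [ b ])
  last-view a []           b _    = inj₁ refl
  last-view a (c ∷ [])     b refl = inj₂ refl
  last-view a (c ∷ d ∷ ps) b eq with last-view c (d ∷ ps) b eq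
  ... | inj₁ ()
  ... | inj₂ e = inj₂ (cong (c ∷_) e)

  interior-not-ends : ∀ (l : List A) {a b z} → Unique l → head l ≡ just a → last l ≡ just b →
    z ∈ interior l → (z ≢ a) × (z ≢ b)
  interior-not-ends (a ∷ ps) {b = b} {z} (a∉ ∷ ups) refl lst m with last-view a ps b lst
  ... | inj₁ refl = ⊥-elim (¬Any[] m)
  ... | inj₂ ps≡ = (λ z≡a → All.lookup a∉ (subst (z ∈_) (sym ps≡) (∈-++⁺ˡ m)) (sym z≡a))
                 , (λ z≡b → Unique-∷ʳ⇒∉ (dropLast ps) (subst Unique ps≡ ups) (subst (_∈ dropLast ps) z≡b m))

  only-ends⇒middle-free : ∀ {P : A → Set} h mid t → Unique (h ∷ mid ++ [ t ]) →
    All (λ z → P z → (z ≡ h) ⊎ (z ≡ t)) (h ∷ mid ++ [ t ]) → ∀ {z} → z ∈ mid → ¬ P z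
  only-ends⇒middle-free h mid t (h∉ ∷ u) only m Pz with All.lookup only (there (∈-++⁺ˡ m)) Pz
  ... | inj₁ refl = All.lookup h∉ (∈-++⁺ˡ m) refl
  ... | inj₂ refl = Unique-∷ʳ⇒∉ mid u m

  Infix : List A → List A → Set
  Infix Q u = Σ (List A) λ X → Σ (List A) λ Y → u ≡ X ++ Q ++ Y

  reversed-block : ∀ (X : List A) x xs Y → X ++ reverse (x ∷ xs) ++ Y ≡ (X ++ reverse xs) ++ x ∷ Y
  reversed-block X x xs Y = begin
    X ++ reverse (x ∷ xs) ++ Y       ≡⟨ cong (λ z → X ++ z ++ Y) (unfold-reverse x xs) ⟩
    X ++ (reverse xs ++ [ x ]) ++ Y  ≡⟨ cong (X ++_) (++-assoc (reverse xs) [ x ] Y) ⟩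
    X ++ reverse xs ++ x ∷ Y         ≡⟨ ++-assoc X (reverse xs) (x ∷ Y) ⟨
    (X ++ reverse xs) ++ x ∷ Y       ∎
    where open ≡-Reasoning

  module _ {u : List A} (uu : Unique u) {a b : A} (ab : (a , b) ∈ edges u) where

    edge-before : ∀ {X R} → u ≡ X ++ b ∷ R → Σ (List A) λ P → X ≡ P ++ [ a ]
    edge-before {X} eq with edge-split u ab
    ... | P , B , eq′ = P , sym (proj₁ (unique-position (P ++ [ a ]) X (subst Unique u≡ uu) (trans (sym u≡) eq)))
      where u≡ : u ≡ (P ++ [ a ]) ++ b ∷ B
            u≡ = trans eq′ (sym (++-assoc P [ a ] (b ∷ B)))

    edge-after : ∀ {X R} → u ≡ X ++ a ∷ R → Σ (List A) λ R′ → R ≡ b ∷ R′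
    edge-after {X} eq with edge-split u ab
    ... | P , B , eq′ = B , sym (proj₂ (unique-position P X (subst Unique eq′ uu) (trans (sym eq′) eq)))

  -- If the pair
  -- points the "wrong" way, rest must be empty, since otherwise q would
  -- also be the neighbour of q′ inside the occurrence.
  extend-infix : ∀ {u : List A} → Unique u → ∀ q q′ rest → All (q ≢_) (q′ ∷ rest) → (q , q′) ∈ᵉ edges u →
    Infix (q′ ∷ rest) u ⊎ Infix (reverse (q′ ∷ rest)) u →
    Infix (q ∷ q′ ∷ rest) u ⊎ Infix (reverse (q ∷ q′ ∷ rest)) u
  extend-infix uu q q′ rest _ (inj₁ fwd) (inj₁ (X , Y , eq)) with edge-before uu fwd eq
  ... | P , refl = inj₁ (P , Y , trans eq (++-assoc P [ q ] _))
  extend-infix uu q q′ [] _ (inj₂ bwd) (inj₁ (X , Y , eq)) with edge-after uu bwd eq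
  ... | R′ , refl = inj₂ (X , R′ , eq)
  extend-infix uu q q′ (r ∷ rest) q∉ (inj₂ bwd) (inj₁ (X , Y , eq)) with edge-after uu bwd eq
  ... | R′ , r∷≡ = ⊥-elim (All.lookup q∉ (there (here (sym (proj₁ (∷-injective r∷≡))))) refl)
  extend-infix uu q q′ rest _ (inj₂ bwd) (inj₂ (X , Y , eq))
    with edge-after uu bwd (trans eq (reversed-block X q′ rest Y))
  ... | Y′ , refl = inj₂ (X , Y′ , trans eq (trans (sym (++-assoc X (reverse (q′ ∷ rest)) (q ∷ Y′)))
                                                  (sym (reversed-block X q (q′ ∷ rest) Y′))))
  extend-infix uu q q′ [] _ (inj₁ fwd) (inj₂ (X , Y , eq))
    with edge-before uu fwd (trans eq (reversed-block X q′ [] Y))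
  ... | P , X≡ = inj₁ (P , Y , trans eq (trans (reversed-block X q′ [] Y)
                                  (trans (cong (_++ q′ ∷ Y) X≡) (++-assoc P [ q ] (q′ ∷ Y)))))
  extend-infix uu q q′ (r ∷ rest) q∉ (inj₁ fwd) (inj₂ (X , Y , eq))
    with edge-before uu fwd (trans eq (reversed-block X q′ (r ∷ rest) Y))
  ... | P , X≡ = ⊥-elim (All.lookup q∉ (there (here (sym r≡q))) refl)
    where r≡q : r ≡ q
          r≡q = ∷ʳ-injectiveʳ (X ++ reverse rest) P
                  (trans (sym (reversed-block X r rest [])) (trans (cong (X ++_) (++-identityʳ _)) X≡))

  infix-or-reverse : ∀ {u : List A} → Unique u → ∀ q qs → Unique (q ∷ qs) → All (_∈ u) (q ∷ qs) →
    All (_∈ᵉ edges u) (edges (q ∷ qs)) → Infix (q ∷ qs) u ⊎ Infix (reverse (q ∷ qs)) u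
  infix-or-reverse uu q [] _ (q∈ ∷ []) _ with ∈-∃++ q∈
  ... | X , Y , eq = inj₁ (X , Y , eq)
  infix-or-reverse uu q (q′ ∷ rest) (q∉ ∷ uQ) (_ ∷ ms) (qq′ ∷ es) =
    extend-infix uu q q′ rest q∉ qq′ (infix-or-reverse uu q′ rest uQ ms es)

  rotate-elements : ∀ (pre : List A) v post → pre ++ v ∷ post ↭ (post ++ pre) ++ [ v ]
  rotate-elements pre v post = Perm.trans (++-comm pre (v ∷ post)) (∷↭∷ʳ v (post ++ pre))

  rotate-edges : ∀ (pre : List A) v post →
    edges ((pre ++ v ∷ post) ++ take 1 (pre ++ v ∷ post)) ↭ edges (v ∷ (post ++ pre) ++ [ v ])
  rotate-edges []        v post = ↭-reflexive (cong (λ z → edges (v ∷ z ++ [ v ])) (sym (++-identityʳ post)))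
  rotate-edges (p ∷ pre) v post = begin
    edges ((p ∷ pre ++ v ∷ post) ++ [ p ])
      ≡⟨ cong edges (++-assoc (p ∷ pre) (v ∷ post) [ p ]) ⟩
    edges ((p ∷ pre) ++ v ∷ post ++ [ p ])
      ≡⟨ edges-++-∷ (p ∷ pre) v (post ++ [ p ]) ⟩
    edges (p ∷ pre ++ [ v ]) ++ edges (v ∷ post ++ [ p ])
      ↭⟨ ++-comm (edges (p ∷ pre ++ [ v ])) (edges (v ∷ post ++ [ p ])) ⟩
    edges (v ∷ post ++ [ p ]) ++ edges (p ∷ pre ++ [ v ])
      ≡⟨ edges-++-∷ (v ∷ post) p (pre ++ [ v ]) ⟨
    edges ((v ∷ post) ++ p ∷ pre ++ [ v ])
      ≡⟨ cong (λ z → edges (v ∷ z)) (++-assoc post (p ∷ pre) [ v ]) ⟨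
    edges (v ∷ (post ++ p ∷ pre) ++ [ v ]) ∎
    where open Perm.PermutationReasoning

open ListFacts

⊓-transfer-≤ : ∀ f w g → f ⊓ (w + g) ≤ ((f + w) ⊓ g) + w
⊓-transfer-≤ f w g = subst (f ⊓ (w + g) ≤_) (sym (+-distribʳ-⊓ w (f + w) g))
  (⊓-mono-≤ (≤-trans (m≤m+n f w) (m≤m+n (f + w) w)) (≤-reflexive (+-comm w g)))

⊓-transfer-≥ : ∀ f w g → (f + w) ⊓ g ≤ (f ⊓ (w + g)) + w
⊓-transfer-≥ f w g = subst ((f + w) ⊓ g ≤_) (sym (+-distribʳ-⊓ w f (w + g)))
  (⊓-mono-≤ ≤-refl (≤-trans (m≤n+m g w) (m≤m+n (w + g) w)))

module WalkLength (G : WGraph) where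
  open WGraph G

  pathLen-++-∷ : ∀ (A : List V) z B → pathLen G (A ++ z ∷ B) ≡ pathLen G (A ++ [ z ]) + pathLen G (z ∷ B)
  pathLen-++-∷ []           z B = refl
  pathLen-++-∷ (a ∷ [])     z B = cong (_+ pathLen G (z ∷ B)) (sym (+-identityʳ (w a z)))
  pathLen-++-∷ (a ∷ a′ ∷ A) z B =
    trans (cong (w a a′ +_) (pathLen-++-∷ (a′ ∷ A) z B)) (sym (+-assoc (w a a′) _ _))

  pathLen-prefix-≤ : ∀ (l m : List V) → pathLen G l ≤ pathLen G (l ++ m)
  pathLen-prefix-≤ []          m = z≤n
  pathLen-prefix-≤ (x ∷ [])    m = z≤n
  pathLen-prefix-≤ (x ∷ y ∷ l) m = +-monoʳ-≤ (w x y) (pathLen-prefix-≤ (y ∷ l) m)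

  -- Edge lengths are symmetric, so reversal preserves length.
  pathLen-reverse : ∀ (l : List V) → pathLen G (reverse l) ≡ pathLen G l
  pathLen-reverse []          = refl
  pathLen-reverse (x ∷ [])    = refl
  pathLen-reverse (x ∷ y ∷ l) = begin
    pathLen G (reverse (x ∷ y ∷ l))
      ≡⟨ cong (pathLen G) (reverse-++ (x ∷ [ y ]) l) ⟩
    pathLen G (reverse l ++ y ∷ [ x ])
      ≡⟨ pathLen-++-∷ (reverse l) y [ x ] ⟩
    pathLen G (reverse l ++ [ y ]) + (w y x + 0)
      ≡⟨ cong₂ _+_ (trans (cong (pathLen G) (sym (unfold-reverse y l))) (pathLen-reverse (y ∷ l)))
                   (trans (+-identityʳ _) (w-sym y x)) ⟩
    pathLen G (y ∷ l) + w x y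
      ≡⟨ +-comm _ (w x y) ⟩
    w x y + pathLen G (y ∷ l) ∎
    where open ≡-Reasoning

-- The cycle o cut open at its vertex v: the closed walk  v ∷ u  with
-- u = (post ++ pre) ++ [v]  runs once around o.
module CutCycle (G : WGraph) (o : List (WGraph.V G)) (v : WGraph.V G) (cyc : IsCycle G o)
                (pre post : List (WGraph.V G)) (o≡ : o ≡ pre ++ v ∷ post) where
  open WGraph G
  open WalkLength G

  u : List V
  u = (post ++ pre) ++ [ v ]

  walk : List V
  walk = v ∷ u

  L : ℕ
  L = pathLen G walk

  o↭u : o ↭ u
  o↭u = subst (_↭ u) (sym o≡) (rotate-elements pre v post)

  cycleEdges↭walk : cycleEdges G o ↭ edges walk
  cycleEdges↭walk = subst (λ z → edges (z ++ take 1 z) ↭ edges walk) (sym o≡) (rotate-edges pre v post)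

  unique-u : Unique u
  unique-u = Unique-resp-↭ o↭u (proj₁ (proj₂ cyc))

  ∈-o⇒∈-u : ∀ {z} → z ∈ o → z ∈ u
  ∈-o⇒∈-u = ∈-resp-↭ o↭u

  ∈-u⇒∈-o : ∀ {z} → z ∈ u → z ∈ o
  ∈-u⇒∈-o = ∈-resp-↭ (↭-sym o↭u)

  edge-o⇒edge-walk : ∀ {e} → e ∈ᵉ cycleEdges G o → e ∈ᵉ edges walk
  edge-o⇒edge-walk (inj₁ p) = inj₁ (∈-resp-↭ cycleEdges↭walk p)
  edge-o⇒edge-walk (inj₂ p) = inj₂ (∈-resp-↭ cycleEdges↭walk p)

  edge-walk⇒edge-o : ∀ {e} → e ∈ᵉ edges walk → e ∈ᵉ cycleEdges G o
  edge-walk⇒edge-o (inj₁ p) = inj₁ (∈-resp-↭ (↭-sym cycleEdges↭walk) p)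
  edge-walk⇒edge-o (inj₂ p) = inj₂ (∈-resp-↭ (↭-sym cycleEdges↭walk) p)

  walk-adjacent : ∀ {a b} → (a , b) ∈ᵉ edges walk → Adj G a b
  walk-adjacent e with edge-walk⇒edge-o e
  ... | inj₁ p = All.lookup (proj₂ (proj₂ cyc)) p
  ... | inj₂ p = subst (1 ≤_) (w-sym _ _) (All.lookup (proj₂ (proj₂ cyc)) p)

  pathIn-o : ∀ R → 1 ≤ length R → Unique R → All (_∈ u) R → All (_∈ᵉ edges walk) (edges R) → PathIn G o R
  pathIn-o R len uR ms es =
    (len , uR , All.map (λ {e} → adjacent e) es) , All.map ∈-u⇒∈-o ms , All.map edge-walk⇒edge-o es
    where adjacent : ∀ e → e ∈ᵉ edges walk → Adj G (proj₁ e) (proj₂ e)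
          adjacent (a , b) p = walk-adjacent p


  walk-edge-avoiding-v : ∀ {a b} → (a , b) ∈ᵉ edges walk → a ≢ v → b ≢ v → (a , b) ∈ᵉ edges u
  walk-edge-avoiding-v (inj₁ p) a≢v _ with edges-∷-cases v u p
  ... | inj₁ (a≡v , _) = ⊥-elim (a≢v a≡v)
  ... | inj₂ p′        = inj₁ p′
  walk-edge-avoiding-v (inj₂ p) _ b≢v with edges-∷-cases v u p
  ... | inj₁ (b≡v , _) = ⊥-elim (b≢v b≡v)
  ... | inj₂ p′        = inj₂ p′

  -- ArcDist z n: cutting the walk at z (u = A ++ z ∷ B), n is the shorter of
  -- the two arcs joining z to v.
  ArcDist : V → ℕ → Set
  ArcDist z n = Σ (List V) λ A → Σ (List V) λ B →
    u ≡ A ++ z ∷ B × n ≡ pathLen G (v ∷ A ++ [ z ]) ⊓ pathLen G (z ∷ B)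

  arcDist : ∀ {z} → z ∈ u → Σ ℕ (ArcDist z)
  arcDist m with ∈-∃++ m
  ... | A , B , eq = _ , A , B , eq , refl

  arcDist-v : ∀ {n} → ArcDist v n → n ≤ 0
  arcDist-v (A , B , eq , refl) with unique-position A (post ++ pre) (subst Unique eq unique-u) (sym eq)
  ... | _ , refl = m⊓n≤n _ 0

  arcDist-step : ∀ P a b B → u ≡ P ++ a ∷ b ∷ B → ∀ {n m} → ArcDist a n → ArcDist b m →
    (n ≤ m + w a b) × (m ≤ n + w a b)
  arcDist-step P a b B eq (A₁ , B₁ , eq₁ , refl) (A₂ , B₂ , eq₂ , refl)
    with unique-position A₁ P (subst Unique eq₁ unique-u) (trans (sym eq₁) eq)
       | unique-position A₂ (P ++ [ a ]) (subst Unique eq₂ unique-u)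
           (trans (sym eq₂) (trans eq (sym (++-assoc P [ a ] (b ∷ B)))))
  ... | refl , refl | refl , refl =
      subst (λ k → f ⊓ (w a b + g) ≤ (k ⊓ g) + w a b) (sym f+w) (⊓-transfer-≤ f (w a b) g)
    , subst (λ k → (k ⊓ g) ≤ (f ⊓ (w a b + g)) + w a b) (sym f+w) (⊓-transfer-≥ f (w a b) g)
    where
    f = pathLen G (v ∷ A₁ ++ [ a ])
    g = pathLen G (b ∷ B)
    f+w : pathLen G (v ∷ (A₁ ++ [ a ]) ++ [ b ]) ≡ f + w a b
    f+w = trans (cong (λ z → pathLen G (v ∷ z)) (++-assoc A₁ [ a ] [ b ]))
                (trans (pathLen-++-∷ (v ∷ A₁) a [ b ]) (cong (f +_) (+-identityʳ (w a b))))

  arcDist-first-step : ∀ {c n m} → head u ≡ just c → ArcDist v n → ArcDist c m →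
    (n ≤ m + w v c) × (m ≤ n + w v c)
  arcDist-first-step {c} {n} {m} hc dv (A , B , eq , refl) =
    ≤-trans (arcDist-v dv) z≤n , ≤-trans m≤w (m≤n+m _ n)
    where
    m≤w : m ≤ w v c
    m≤w rewrite head-position u A unique-u hc eq = ≤-trans (m⊓n≤m _ _) (≤-reflexive (+-identityʳ (w v c)))

  arcDist-walk-step : ∀ {a b n m} → (a , b) ∈ edges walk → ArcDist a n → ArcDist b m →
    (n ≤ m + w a b) × (m ≤ n + w a b)
  arcDist-walk-step p with edges-∷-cases v u p
  ... | inj₁ (refl , hc) = arcDist-first-step hc
  ... | inj₂ p′ with edge-split u p′
  ...   | P , B , eq = arcDist-step P _ _ B eq

  arcDist-lipschitz : ∀ {a b n m} → (a , b) ∈ᵉ edges walk → ArcDist a n → ArcDist b m → n ≤ m + w a b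
  arcDist-lipschitz (inj₁ p) da db = proj₁ (arcDist-walk-step p da db)
  arcDist-lipschitz {a} {b} {n} {m} (inj₂ p) da db =
    subst (λ k → n ≤ m + k) (w-sym b a) (proj₂ (arcDist-walk-step p db da))

  -- Summing the Lipschitz bound along a walk in o that ends at v.
  arcDist≤pathLen : ∀ R → All (_∈ u) R → All (_∈ᵉ edges walk) (edges R) → last R ≡ just v →
    ∀ {z n} → head R ≡ just z → ArcDist z n → n ≤ pathLen G R
  arcDist≤pathLen (z ∷ [])      _              _        refl refl dz = ≤-trans (arcDist-v dz) z≤n
  arcDist≤pathLen (z ∷ z′ ∷ rs) (_ ∷ z′∈ ∷ ms) (e ∷ es) lst  refl dz with arcDist z′∈
  ... | k , dz′ = ≤-trans (arcDist-lipschitz e dz dz′)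
        (subst (k + w z z′ ≤_) (+-comm (pathLen G (z′ ∷ rs)) (w z z′))
          (+-monoˡ-≤ (w z z′) (arcDist≤pathLen (z′ ∷ rs) (z′∈ ∷ ms) es lst refl dz′)))

  distance-lower-bound : ∀ {x n} → ArcDist x n → ∀ R → PathIn G o R → IsPathFromTo G R x v → n ≤ pathLen G R
  distance-lower-bound dx R (_ , ms , es) (_ , hd , lst) =
    arcDist≤pathLen R (All.map ∈-o⇒∈-u ms) (All.map edge-o⇒edge-walk es) lst hd dx

module Inclusion (G : WGraph) where
  open WGraph G

  infix-included : ∀ A Q B {R} → R ≡ A ++ Q ++ B → PathIncluded G Q R
  infix-included A Q B eq =
      All.tabulate (λ m → subst (_ ∈_) (sym eq) (∈-++⁺ʳ A (∈-++⁺ˡ m)))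
    , All.tabulate (λ {e} m → inj₁ (subst (λ z → e ∈ edges z) (sym eq) (edges-++⁺ʳ A (edges-++⁺ˡ Q m))))

  included-reverseˡ : ∀ {Q R} → PathIncluded G Q R → PathIncluded G (reverse Q) R
  included-reverseˡ {Q} {R} (vs , es) =
    All.tabulate (λ m → All.lookup vs (reverse⁻ m)) , All.tabulate (λ {e} → edge e)
    where edge : ∀ e → e ∈ edges (reverse Q) → e ∈ᵉ edges R
          edge (a , b) m = ∈ᵉ-swap (All.lookup es (edges-reverse⁻ Q m))

  included-reverseʳ : ∀ {Q R} → PathIncluded G Q R → PathIncluded G Q (reverse R)
  included-reverseʳ {R = R} (vs , es) = All.map reverse⁺ vs , All.map (λ {e} → edge e) es
    where edge : ∀ e → e ∈ᵉ edges R → e ∈ᵉ edges (reverse R)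
          edge (a , b) (inj₁ p) = inj₂ (edges-reverse⁺ R p)
          edge (a , b) (inj₂ p) = inj₁ (edges-reverse⁺ R p)

  Oriented : List V → V → List V → V → Set
  Oriented Q h mid t = (Q ≡ h ∷ mid ++ [ t ]) ⊎ (Q ≡ reverse (h ∷ mid ++ [ t ]))

  oriented-included : ∀ {Q h mid t R} → Oriented Q h mid t → PathIncluded G (h ∷ mid ++ [ t ]) R → PathIncluded G Q R
  oriented-included (inj₁ refl) p = p
  oriented-included (inj₂ refl) p = included-reverseˡ p

  oriented-endʳ : ∀ {Q h mid t} → Oriented Q h mid t → (head Q ≡ just t) ⊎ (last Q ≡ just t)
  oriented-endʳ {h = h} {mid} {t} (inj₁ refl) = inj₂ (last-∷ʳ (h ∷ mid) t)
  oriented-endʳ {h = h} {mid} {t} (inj₂ refl) = inj₁ (cong head (reverse-∷-∷ʳ h mid t))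

  oriented-endˡ : ∀ {Q h mid t} → Oriented Q h mid t → (head Q ≡ just h) ⊎ (last Q ≡ just h)
  oriented-endˡ (inj₁ refl) = inj₁ refl
  oriented-endˡ {h = h} {mid} {t} (inj₂ refl) =
    inj₂ (trans (cong last (reverse-∷-∷ʳ h mid t)) (last-∷ʳ (t ∷ reverse mid) h))

module Segments (G : WGraph) {r : ℕ∞} (θ : Theta G r) (o : List (WGraph.V G)) (v : WGraph.V G)
                (cyc : IsCycle G o) (pre post : List (WGraph.V G)) (o≡ : o ≡ pre ++ v ∷ post) where
  open WGraph G
  open WalkLength G
  open Inclusion G
  open CutCycle G o v cyc pre post o≡ public

  record Segment (Q : List V) : Set where
    field
      X Y mid     : List V
      h t         : V
      position    : u ≡ X ++ h ∷ mid ++ t ∷ Y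
      orientation : Oriented Q h mid t
      h∈θ         : InΘ G θ h
      t∈θ         : InΘ G θ t
      mid∉θ       : ∀ {z} → z ∈ mid → ¬ InΘ G θ z
      t≢v         : t ≢ v

    K : List V
    K = X ++ h ∷ mid

    s e : ℕ
    s = pathLen G (v ∷ X ++ [ h ])
    e = pathLen G (v ∷ K ++ [ t ])

    forward-arc : List V
    forward-arc = h ∷ mid ++ t ∷ Y

    position-t : u ≡ (K ++ [ t ]) ++ Y
    position-t = trans position (trans (sym (++-assoc X (h ∷ mid) (t ∷ Y))) (sym (++-assoc K [ t ] Y)))

  module _ {Q : List V} (S : Segment Q) where
    open Segment S

    backward-arc : List V
    backward-arc = reverse (v ∷ K ++ [ t ])

    L≡e+rest : L ≡ e + pathLen G (t ∷ Y)
    L≡e+rest = trans (cong (λ z → pathLen G (v ∷ z)) (trans position-t (++-assoc K [ t ] Y)))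
                     (pathLen-++-∷ (v ∷ K) t Y)

    -- v is the last vertex of u, and t ≢ v, so v does not occur up to t.
    v∉K∷ʳt : v ∉ K ++ [ t ]
    v∉K∷ʳt m with ∈-∃++ m
    ... | P , B , eq = v-last B Y eq (proj₂ (unique-position P (post ++ pre) (subst Unique u≡ unique-u) (sym u≡)))
      where
      u≡ : u ≡ P ++ v ∷ (B ++ Y)
      u≡ = trans position-t (trans (cong (_++ Y) eq) (++-assoc P (v ∷ B) Y))
      v-last : ∀ B Y → K ++ [ t ] ≡ P ++ v ∷ B → B ++ Y ≡ [] → ⊥
      v-last []      []      eq′ _ = t≢v (∷ʳ-injectiveʳ K P eq′)
      v-last []      (_ ∷ _) _   ()
      v-last (_ ∷ _) _       _   ()

    backward-arc-in-o : PathIn G o backward-arc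
    backward-arc-in-o = pathIn-o backward-arc len uniq (All.tabulate vertex) (All.tabulate (λ {e′} → edge e′))
      where
      len : 1 ≤ length backward-arc
      len = subst (λ z → 1 ≤ length z) (sym (reverse-∷-∷ʳ v K t)) (s≤s z≤n)
      uniq : Unique backward-arc
      uniq = Unique-resp-↭ (↭-sym (↭-reverse (v ∷ K ++ [ t ])))
        (All.tabulate (λ m v≡ → v∉K∷ʳt (subst (_∈ K ++ [ t ]) (sym v≡) m))
          ∷ Unique-++⁻ˡ (K ++ [ t ]) (subst Unique position-t unique-u))
      vertex : ∀ {z} → z ∈ backward-arc → z ∈ u
      vertex m with reverse⁻ {xs = v ∷ K ++ [ t ]} m
      ... | here refl = ∈-++⁺ʳ (post ++ pre) (here refl)
      ... | there m′  = subst (_ ∈_) (sym position-t) (∈-++⁺ˡ m′)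
      edge : ∀ e′ → e′ ∈ edges backward-arc → e′ ∈ᵉ edges walk
      edge (a , b) m = inj₂ (subst (λ z → (b , a) ∈ edges (v ∷ z)) (sym position-t)
                         (edges-++⁺ˡ (v ∷ K ++ [ t ]) (edges-reverse⁻ (v ∷ K ++ [ t ]) m)))

    backward-arc-from-t : IsPathFromTo G backward-arc t v
    backward-arc-from-t = proj₁ backward-arc-in-o , cong head (reverse-∷-∷ʳ v K t)
                        , trans (cong last (reverse-∷-∷ʳ v K t)) (last-∷ʳ (t ∷ reverse K) v)

    backward-arc-length : pathLen G backward-arc ≡ e
    backward-arc-length = pathLen-reverse (v ∷ K ++ [ t ])

    segment-in-backward-arc : PathIncluded G (h ∷ mid ++ [ t ]) backward-arc
    segment-in-backward-arc = included-reverseʳ (infix-included (v ∷ X) (h ∷ mid ++ [ t ]) [] block)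
      where block : v ∷ K ++ [ t ] ≡ (v ∷ X) ++ (h ∷ mid ++ [ t ]) ++ []
            block = cong (v ∷_) (trans (++-assoc X (h ∷ mid) [ t ]) (cong (X ++_) (sym (++-identityʳ _))))

    primary-if-2e≤L : e + e ≤ L → Primary G θ o v Q
    primary-if-2e≤L 2e≤L = t , oriented-endʳ orientation , backward-arc
                         , (backward-arc-in-o , backward-arc-from-t , shortest)
                         , oriented-included orientation segment-in-backward-arc
      where
      e≤rest : e ≤ pathLen G (t ∷ Y)
      e≤rest = +-cancelˡ-≤ e _ _ (subst (e + e ≤_) L≡e+rest 2e≤L)
      shortest : ∀ R → PathIn G o R → IsPathFromTo G R t v → pathLen G backward-arc ≤ pathLen G R
      shortest R inR fromTo = subst (_≤ pathLen G R) (trans (m≤n⇒m⊓n≡m e≤rest) (sym backward-arc-length))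
        (distance-lower-bound (K , Y , trans position-t (++-assoc K [ t ] Y) , refl) R inR fromTo)

    L≡s+forward : L ≡ s + pathLen G forward-arc
    L≡s+forward = trans (cong (λ z → pathLen G (v ∷ z)) position) (pathLen-++-∷ (v ∷ X) h (mid ++ t ∷ Y))

    forward-arc-in-o : PathIn G o forward-arc
    forward-arc-in-o = pathIn-o forward-arc (s≤s z≤n) (Unique-++⁻ʳ X (subst Unique position unique-u))
      (All.tabulate (λ m → subst (_ ∈_) (sym position) (∈-++⁺ʳ X m)))
      (All.tabulate (λ {e′} m → inj₁ (subst (λ z → e′ ∈ edges (v ∷ z)) (sym position)
                                           (edges-++⁺ʳ (v ∷ X) m))))

    forward-arc-from-h : IsPathFromTo G forward-arc h v
    forward-arc-from-h = proj₁ forward-arc-in-o , refl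
      , trans (sym (last-++-∷ X h (mid ++ t ∷ Y))) (trans (cong last (sym position)) (last-∷ʳ (post ++ pre) v))

    segment-in-forward-arc : PathIncluded G (h ∷ mid ++ [ t ]) forward-arc
    segment-in-forward-arc = infix-included [] (h ∷ mid ++ [ t ]) Y (sym (++-assoc (h ∷ mid) [ t ] Y))

    primary-if-L≤2s : L ≤ s + s → Primary G θ o v Q
    primary-if-L≤2s L≤2s = h , oriented-endˡ orientation , forward-arc
                         , (forward-arc-in-o , forward-arc-from-h , shortest)
                         , oriented-included orientation segment-in-forward-arc
      where
      forward≤s : pathLen G forward-arc ≤ s
      forward≤s = +-cancelˡ-≤ s _ _ (subst (_≤ s + s) L≡s+forward L≤2s)
      shortest : ∀ R → PathIn G o R → IsPathFromTo G R h v → pathLen G forward-arc ≤ pathLen G R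
      shortest R inR fromTo = subst (_≤ pathLen G R) (m≥n⇒m⊓n≡n forward≤s)
        (distance-lower-bound (X , mid ++ t ∷ Y , position , refl) R inR fromTo)

    primary-or-straddles : Primary G θ o v Q ⊎ ((s + s < L) × (L < e + e))
    primary-or-straddles with e + e ≤? L | L ≤? s + s
    ... | yes 2e≤L | _        = inj₁ (primary-if-2e≤L 2e≤L)
    ... | no _     | yes L≤2s = inj₁ (primary-if-L≤2s L≤2s)
    ... | no 2e≰L  | no L≰2s  = inj₂ (≰⇒> L≰2s , ≰⇒> 2e≰L)

  Straddling : List V → Set
  Straddling Q = Σ (Segment Q) λ S → (Segment.s S + Segment.s S < L) × (L < Segment.e S + Segment.e S)

  non-primary⇒straddling : ∀ {Q} → Segment Q → ¬ Primary G θ o v Q → Straddling Q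
  non-primary⇒straddling S ¬primary with primary-or-straddles S
  ... | inj₁ primary  = ⊥-elim (¬primary primary)
  ... | inj₂ straddle = S , straddle

  walk-monotone : ∀ (K K′ : List V) {t h′ Y rest} → t ∷ Y ≡ K′ ++ h′ ∷ rest →
    pathLen G (v ∷ K ++ [ t ]) ≤ pathLen G (v ∷ (K ++ K′) ++ [ h′ ])
  walk-monotone K []        refl = ≤-reflexive (cong (λ z → pathLen G (v ∷ z ++ [ _ ])) (sym (++-identityʳ K)))
  walk-monotone K (k ∷ K″) {t} {h′} refl =
    subst (λ z → pathLen G (v ∷ K ++ [ t ]) ≤ pathLen G (v ∷ z)) (sym regroup)
      (pathLen-prefix-≤ (v ∷ K ++ [ t ]) (K″ ++ [ h′ ]))
    where regroup : (K ++ t ∷ K″) ++ [ h′ ] ≡ (K ++ [ t ]) ++ (K″ ++ [ h′ ])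
          regroup = trans (++-assoc K (t ∷ K″) [ h′ ]) (sym (++-assoc K [ t ] (K″ ++ [ h′ ])))

  SameBlock : ∀ {Q₁ Q₂} → Segment Q₁ → Segment Q₂ → Set
  SameBlock S₁ S₂ = (Segment.h S₁ ≡ Segment.h S₂) × (Segment.mid S₁ ≡ Segment.mid S₂)
                  × (Segment.t S₁ ≡ Segment.t S₂)

  -- If segment 1 starts no later than segment 2 (u = X₁ ++ M ++ …), 2e₁ > L
  -- and 2s₂ < L, then they occupy the same block: otherwise segment 1 would
  -- end before segment 2 starts, giving e₁ ≤ s₂.
  straddling-ordered : ∀ {Q₁ Q₂} (S₁ : Segment Q₁) (S₂ : Segment Q₂) →
    L < Segment.e S₁ + Segment.e S₁ → Segment.s S₂ + Segment.s S₂ < L → ∀ M →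
    Segment.X S₂ ≡ Segment.X S₁ ++ M → Segment.forward-arc S₁ ≡ M ++ Segment.forward-arc S₂ →
    SameBlock S₁ S₂
  straddling-ordered S₁ S₂ _ _ [] _ eq with ∷-injective eq
  ... | h≡ , eq′ = h≡ , first-hit (Segment.mid S₁) (Segment.mid S₂) (Segment.t∈θ S₁) (Segment.t∈θ S₂)
                                  (Segment.mid∉θ S₁) (Segment.mid∉θ S₂) eq′
  straddling-ordered S₁ S₂ L<2e₁ 2s₂<L (k ∷ M″) X₂≡ eq with ∷-injective eq
  ... | refl , eq′ with hit-before (Segment.mid S₁) M″ (Segment.h∈θ S₂) (Segment.mid∉θ S₁) eq′
  ... | K′ , M″≡ , t≤h = ⊥-elim (<-irrefl refl (<-≤-trans (<-trans 2s₂<L L<2e₁) (+-mono-≤ e₁≤s₂ e₁≤s₂)))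
    where
    X₂≡K₁++K′ : Segment.X S₂ ≡ Segment.K S₁ ++ K′
    X₂≡K₁++K′ = trans X₂≡ (trans (cong (λ z → Segment.X S₁ ++ k ∷ z) M″≡)
                                 (sym (++-assoc (Segment.X S₁) (k ∷ Segment.mid S₁) K′)))
    e₁≤s₂ : Segment.e S₁ ≤ Segment.s S₂
    e₁≤s₂ = subst (λ z → Segment.e S₁ ≤ pathLen G (v ∷ z ++ [ Segment.h S₂ ])) (sym X₂≡K₁++K′)
              (walk-monotone (Segment.K S₁) K′ t≤h)

  straddling-same-block : ∀ {Q₁ Q₂} ((S₁ , _) : Straddling Q₁) ((S₂ , _) : Straddling Q₂) → SameBlock S₁ S₂
  straddling-same-block (S₁ , 2s₁<L , L<2e₁) (S₂ , 2s₂<L , L<2e₂)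
    with ++-cases (Segment.X S₁) (Segment.X S₂) (trans (sym (Segment.position S₁)) (Segment.position S₂))
  ... | inj₁ (M , X≡ , eq) = straddling-ordered S₁ S₂ L<2e₁ 2s₂<L M X≡ eq
  ... | inj₂ (M , X≡ , eq) with straddling-ordered S₂ S₁ L<2e₂ 2s₁<L M X≡ eq
  ...   | h≡ , mid≡ , t≡ = sym h≡ , sym mid≡ , sym t≡

  straddling-unique : ∀ {Q₁ Q₂} → Straddling Q₁ → Straddling Q₂ → (Q₁ ≡ Q₂) ⊎ (Q₁ ≡ reverse Q₂)
  straddling-unique S₁ S₂ =
    same-orientation (Segment.orientation (proj₁ S₁)) (Segment.orientation (proj₁ S₂))
                     (straddling-same-block S₁ S₂)
    where
    same-orientation : ∀ {Q₁ Q₂ h₁ m₁ t₁ h₂ m₂ t₂} → Oriented Q₁ h₁ m₁ t₁ → Oriented Q₂ h₂ m₂ t₂ →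
      (h₁ ≡ h₂) × (m₁ ≡ m₂) × (t₁ ≡ t₂) → (Q₁ ≡ Q₂) ⊎ (Q₁ ≡ reverse Q₂)
    same-orientation (inj₁ refl) (inj₁ refl) (refl , refl , refl) = inj₁ refl
    same-orientation (inj₁ refl) (inj₂ refl) (refl , refl , refl) = inj₂ (sym (reverse-involutive _))
    same-orientation (inj₂ refl) (inj₁ refl) (refl , refl , refl) = inj₂ refl
    same-orientation (inj₂ refl) (inj₂ refl) (refl , refl , refl) = inj₁ refl

module ThetaFacts (G : WGraph) {r : ℕ∞} (θ : Theta G r) where
  open Theta θ

  branching∈θ : ∀ {v} → Branching G θ v → InΘ G θ v
  branching∈θ (inj₁ refl) = Fin.zero , head∈ (arm Fin.zero) (proj₁ (proj₂ (arm-path Fin.zero)))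
  branching∈θ (inj₂ refl) = Fin.zero , last∈ (arm Fin.zero) (proj₂ (proj₂ (arm-path Fin.zero)))

  interior≢branching : ∀ {v z i} → Branching G θ v → z ∈ interior (arm i) → z ≢ v
  interior≢branching {i = i} br m with arm-path i
  ... | (_ , uniq , _) , hd , lst with interior-not-ends (arm i) uniq hd lst m
  interior≢branching (inj₁ refl) m | _ | z≢a , _   = z≢a
  interior≢branching (inj₂ refl) m | _ | _   , z≢b = z≢b

module Bridges (G : WGraph) {r : ℕ∞} (θ : Theta G r) (o : List (WGraph.V G)) (v : WGraph.V G)
               (cyc : IsCycle G o) (pre post : List (WGraph.V G)) (o≡ : o ≡ pre ++ v ∷ post)
               (br : Branching G θ v) where
  open WGraph G
  open ThetaFacts G θ
  open Segments G θ o v cyc pre post o≡ public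

  OnlyEndsOnθ : V → List V → V → Set
  OnlyEndsOnθ h Q t = All (λ z → InΘ G θ z → (z ≡ h) ⊎ (z ≡ t)) Q

  -- v lies on θ, so a path meeting θ only in its ends h, t ≢ v avoids v.
  avoids-v : ∀ {h Q t z} → OnlyEndsOnθ h Q t → h ≢ v → t ≢ v → z ∈ Q → z ≢ v
  avoids-v onlyEnds h≢v t≢v m refl with All.lookup onlyEnds m (branching∈θ br)
  ... | inj₁ refl = h≢v refl
  ... | inj₂ refl = t≢v refl

  block-segment : ∀ h mid t → PathIn G o (h ∷ mid ++ [ t ]) → InΘ G θ h → InΘ G θ t →
    OnlyEndsOnθ h (h ∷ mid ++ [ t ]) t → h ≢ v → t ≢ v → Segment (h ∷ mid ++ [ t ])
  block-segment h mid t ((_ , uQ , _) , inO , edgesO) h∈θ t∈θ onlyEnds h≢v t≢v =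
    segment (infix-or-reverse unique-u h (mid ++ [ t ]) uQ (All.map ∈-o⇒∈-u inO)
                              (All.tabulate (λ {e} → edge e)))
    where
    edge : ∀ e → e ∈ edges (h ∷ mid ++ [ t ]) → e ∈ᵉ edges u
    edge (a , b) m with edge-∈ (h ∷ mid ++ [ t ]) m
    ... | a∈ , b∈ = walk-edge-avoiding-v (edge-o⇒edge-walk (All.lookup edgesO m))
                      (avoids-v onlyEnds h≢v t≢v a∈) (avoids-v onlyEnds h≢v t≢v b∈)
    mid∉θ : ∀ {z} → z ∈ mid → ¬ InΘ G θ z
    mid∉θ = only-ends⇒middle-free h mid t uQ onlyEnds
    segment : Infix (h ∷ mid ++ [ t ]) u ⊎ Infix (reverse (h ∷ mid ++ [ t ])) u → Segment (h ∷ mid ++ [ t ])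
    segment (inj₁ (X , Y , eq)) = record
      { X = X ; Y = Y ; mid = mid ; h = h ; t = t
      ; position = trans eq (cong (X ++_) (++-assoc (h ∷ mid) [ t ] Y))
      ; orientation = inj₁ refl ; h∈θ = h∈θ ; t∈θ = t∈θ ; mid∉θ = mid∉θ ; t≢v = t≢v }
    segment (inj₂ (X , Y , eq)) = record
      { X = X ; Y = Y ; mid = reverse mid ; h = t ; t = h
      ; position = trans eq (trans (cong (λ z → X ++ z ++ Y) (reverse-∷-∷ʳ h mid t))
                                   (cong (X ++_) (++-assoc (t ∷ reverse mid) [ h ] Y)))
      ; orientation = inj₂ (sym (trans (reverse-∷-∷ʳ t (reverse mid) h)
                                       (cong (λ z → h ∷ z ++ [ t ]) (reverse-involutive mid))))
      ; h∈θ = t∈θ ; t∈θ = h∈θ ; mid∉θ = mid∉θ ∘ reverse⁻ ; t≢v = h≢v }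

  -- A secondary bridge has both ends interior to arms, hence distinct from v;
  -- its segment is not primary, so it straddles the antipode of v.
  secondary⇒straddling : ∀ Q → Secondary G θ o v Q → Straddling Q
  secondary⇒straddling Q (((inO , len2 , x , y , hx , ly , x∈θ , y∈θ , onlyEnds , _)
                         , _ , y′ , hx′ , ly′ , i , j , _ , x∈i , y′∈j) , ¬primary)
    with ends-and-middle Q len2
  ... | h , mid , t , refl
    with hx | hx′ | just-injective (trans (sym ly) (last-∷ʳ (h ∷ mid) t))
       | just-injective (trans (sym ly′) (last-∷ʳ (h ∷ mid) t))
  ... | refl | refl | refl | refl =
    non-primary⇒straddling (block-segment h mid t inO x∈θ y∈θ onlyEnds
                              (interior≢branching br x∈i) (interior≢branching br y′∈j)) ¬primary

lemma4p21 : (r : ℕ∞) (G : WGraph) (θ : Theta G r) (o : List (WGraph.V G)) (v : WGraph.V G)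
    → IsCycle G o → cycleLen G o ≤∞ r
    → v ∈ o → Branching G θ v
    → (P : List (WGraph.V G)) → PathIn G o P
    → Σ (WGraph.V G) (λ x → Σ (WGraph.V G) (λ y → head P ≡ just x × last P ≡ just y × JoinsDifferentArms G θ x y))
    → All (λ z → ¬ Branching G θ z) P
    → ∀ Q₁ Q₂ → Secondary G θ o v Q₁ → Secondary G θ o v Q₂
    → (Q₁ ≡ Q₂) ⊎ (Q₁ ≡ reverse Q₂)
lemma4p21 r G θ o v cyc _ v∈o br _ _ _ _ Q₁ Q₂ sec₁ sec₂ with ∈-∃++ v∈o
... | pre , post , o≡ = straddling-unique (secondary⇒straddling Q₁ sec₁) (secondary⇒straddling Q₂ sec₂)
  where open Bridges G θ o v cyc pre post o≡ br
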